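{- There exists a map $m:\mathbb{N}\times\mathbb{N}\to\mathbb{N}$ such that for all $h,l,n\in\mathbb{N}$ the interval $[n,n+m(h,l)]$ contains a set $S$ with the following properties: (i) $S=\bigcup_{i=1}^h[x_i,x_i+2l]$ for some strictly increasing sequence $(x_i)_{i=1}^h$ in $\mathbb{N}$; (ii) $\gcd(a,b)\in T(l)$ for all $a,b\in S$ with $a\ne b$.
   Context: $\mathbb{N}=\{1,2,3,\dots\}$, $\mathbb{P}$ is the set of primes, $[a,b]=\{x\in\mathbb{Z}:a\le x\le b\}$. For $l\in\mathbb{N}$ and prime $p$, $r(p,l)=\max\{t\in\mathbb{N}\cup\{0\}: p^t\le 2l+1\}$, and $T(l)=\{\prod_{p\in\mathbb{P}\cap[2,2l+1]}p^{r_p}: 0\le r_p\le r(p,l)\}$. -}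

module Defs where

open import Data.Nat using (ℕ; zero; suc; _+_; _*_; _^_; _≤_; _<_; _≤?_)
open import Data.Nat.GCD using (gcd)
open import Data.Nat.Primality using (Prime; prime?)
open import Data.List using (List; map; filter; upTo)
open import Data.Nat.ListAction using (product)
open import Data.Fin using (Fin)
open import Data.Product using (Σ; _×_)
open import Relation.Nullary using (¬_; yes; no)
open import Relation.Binary.PropositionalEquality using (_≡_)

maxExp : ℕ → ℕ → ℕ → ℕ
maxExp p N zero = 0
maxExp p N (suc k) with p ^ suc k ≤? N
... | yes _ = suc k
... | no _ = maxExp p N k

-- r(p,l) = max { t ≥ 0 : p^t ≤ 2l+1 }  (for p ≥ 2 such t is < 2l+1)
r : ℕ → ℕ → ℕ
r p l = maxExp p (2 * l + 1) (2 * l + 1)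

primesUpTo : ℕ → List ℕ
primesUpTo l = filter prime? (upTo (2 * l + 2))

InT : ℕ → ℕ → Set
InT l d = Σ (ℕ → ℕ) λ e →
  ((p : ℕ) → Prime p → p ≤ 2 * l + 1 → e p ≤ r p l) ×
  (d ≡ product (map (λ p → p ^ e p) (primesUpTo l)))

InS : ∀ {h} → ℕ → (Fin h → ℕ) → ℕ → Set
InS {h} l x a = Σ (Fin h) λ i → (x i ≤ a) × (a ≤ x i + 2 * l)

StrictlyIncreasing : ∀ {h} → (Fin h → ℕ) → Set
StrictlyIncreasing {h} x = ∀ (i j : Fin h) → i Data.Fin.< j → x i < x j

module Submission where

-- Fix K = 2l+1 and the "factorial ladder" c₀ = 1, c_{k+1} = (c_k + K)!.
-- Every d ∈ [1, c_i + K] divides c_j for all j > i.  Take a multiple y of c_h with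
-- n < y ≤ n + c_h and put the h blocks [y + c_i + 1, y + c_i + K], i < h.
-- If g divides two distinct block elements a, b, then g ≤ |a - b| ≤ c_i + K for one of
-- the two block indices i < h, so g ∣ c_h ∣ y; hence g divides the two numbers c_i + s
-- and c_j + t (offsets s, t ∈ [1,K]).  If i < j then g ≤ c_i + K, so g ∣ c_j and g ∣ t;
-- if i = j then g ≤ |s - t|.  Either way g ∈ [1, K], and every such number is in T(l).

open import Defs
open import Data.Nat
open import Data.Nat.Properties
open import Data.Nat.Divisibility
open import Data.Nat.GCD using (gcd; gcd[m,n]∣m; gcd[m,n]∣n)
open import Data.Nat.DivMod using (_/_; _%_; m≡m%n+[m/n]*n; m%n<n; m/n*n≤m)
open import Data.Nat.Primality using (Prime; prime?)
open import Data.Nat.Primality.Factorisation using (factorise; PrimeFactorisation)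
open import Data.Nat.ListAction using (product)
open import Data.Nat.ListAction.Properties using (∈⇒∣product)
open import Data.List using (List; []; _∷_; map)
open import Data.List.Relation.Unary.All using (All; []; _∷_)
import Data.List.Relation.Unary.All as All
open import Data.List.Relation.Unary.Any using (here; there)
open import Data.List.Relation.Unary.AllPairs using (_∷_)
open import Data.List.Relation.Unary.Unique.Propositional using (Unique)
open import Data.List.Relation.Unary.Unique.Propositional.Properties using (upTo⁺; filter⁺)
open import Data.List.Membership.Propositional using (_∈_)
open import Data.List.Membership.Propositional.Properties using (∈-filter⁺; ∈-upTo⁺)
open import Data.Fin using (Fin; toℕ)
open import Data.Fin.Properties using (toℕ<n)
open import Data.Product using (Σ; _×_; _,_; proj₁; proj₂; uncurry)
open import Data.Sum using (inj₁; inj₂)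
open import Function using (_∘_)
open import Algebra.Properties.CommutativeSemigroup *-commutativeSemigroup using (x∙yz≈y∙xz)
open import Relation.Binary using (tri<; tri≈; tri>)
open import Relation.Binary.PropositionalEquality
open import Relation.Nullary using (yes; no)
open import Relation.Nullary.Negation using (contradiction)

t<p^t : ∀ {p} t → 2 ≤ p → t < p ^ t
t<p^t zero _ = z<s
t<p^t {p} (suc t) 2≤p = begin-strict
    suc t          ≤⟨ t<p^t t 2≤p ⟩
    p ^ t          <⟨ m<m+n (p ^ t) (≤-trans z<s (t<p^t t 2≤p)) ⟩
    p ^ t + p ^ t  ≡⟨ cong (p ^ t +_) (sym (+-identityʳ (p ^ t))) ⟩
    2 * p ^ t      ≤⟨ *-monoˡ-≤ (p ^ t) 2≤p ⟩
    p * p ^ t      ∎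
  where open ≤-Reasoning

maxExp-maximal : ∀ p N k {t} → p ^ t ≤ N → t ≤ k → t ≤ maxExp p N k
maxExp-maximal p N zero _ t≤0 = t≤0
maxExp-maximal p N (suc k) {t} p^t≤N t≤1+k with p ^ suc k ≤? N
... | yes _ = t≤1+k
... | no p^1+k≰N = maxExp-maximal p N k p^t≤N (≤-pred (≤∧≢⇒< t≤1+k t≢1+k))
  where
  t≢1+k : t ≢ suc k
  t≢1+k refl = p^1+k≰N p^t≤N

prime⇒2≤ : ∀ {p} → Prime p → 2 ≤ p
prime⇒2≤ {suc (suc _)} _ = s≤s (s≤s z≤n)

-- r(p,l) is the largest exponent t with p^t ≤ 2l+1 (such t are < 2l+1 since p ≥ 2).
r-maximal : ∀ l {p t} → Prime p → p ^ t ≤ 2 * l + 1 → t ≤ r p l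
r-maximal l {p} {t} pp p^t≤ =
  maxExp-maximal p (2 * l + 1) (2 * l + 1) p^t≤ (<⇒≤ (<-≤-trans (t<p^t t (prime⇒2≤ pp)) p^t≤))

prodPow : (ℕ → ℕ) → List ℕ → ℕ
prodPow e ps = product (map (λ p → p ^ e p) ps)

bump : (ℕ → ℕ) → ℕ → ℕ → ℕ
bump e q p with p ≟ q
... | yes _ = suc (e p)
... | no _ = e p

bump-same : ∀ e q → bump e q q ≡ suc (e q)
bump-same e q with q ≟ q
... | yes _ = refl
... | no q≢q = contradiction refl q≢q

bump-other : ∀ e {q p} → p ≢ q → bump e q p ≡ e p
bump-other e {q} {p} p≢q with p ≟ q
... | yes p≡q = contradiction p≡q p≢q
... | no _ = refl

prodPow-zero : ∀ ps → prodPow (λ _ → 0) ps ≡ 1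
prodPow-zero [] = refl
prodPow-zero (p ∷ ps) = trans (+-identityʳ _) (prodPow-zero ps)

prodPow-bump-absent : ∀ e {q} ps → All (q ≢_) ps → prodPow (bump e q) ps ≡ prodPow e ps
prodPow-bump-absent e [] _ = refl
prodPow-bump-absent e (p ∷ ps) (q≢p ∷ q∉ps) =
  cong₂ _*_ (cong (p ^_) (bump-other e (q≢p ∘ sym))) (prodPow-bump-absent e ps q∉ps)

prodPow-bump : ∀ e {q ps} → Unique ps → q ∈ ps → prodPow (bump e q) ps ≡ q * prodPow e ps
prodPow-bump e {q} {q ∷ ps} (q∉ps ∷ _) (here refl) = begin
    q ^ bump e q q * prodPow (bump e q) ps
  ≡⟨ cong₂ _*_ (cong (q ^_) (bump-same e q)) (prodPow-bump-absent e ps q∉ps) ⟩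
    q * q ^ e q * prodPow e ps
  ≡⟨ *-assoc q _ _ ⟩
    q * (q ^ e q * prodPow e ps)
  ∎
  where open ≡-Reasoning
prodPow-bump e {q} {p ∷ ps} (p∉ps ∷ u) (there q∈ps) = begin
    p ^ bump e q p * prodPow (bump e q) ps
  ≡⟨ cong₂ _*_ (cong (p ^_) (bump-other e (All.lookup p∉ps q∈ps))) (prodPow-bump e u q∈ps) ⟩
    p ^ e p * (q * prodPow e ps)
  ≡⟨ x∙yz≈y∙xz (p ^ e p) q _ ⟩
    q * (p ^ e p * prodPow e ps)
  ∎
  where open ≡-Reasoning

exponents : ∀ {ps} → Unique ps → (fs : List ℕ) → All (_∈ ps) fs →
            Σ (ℕ → ℕ) λ e → (∀ p → p ^ e p ∣ product fs) × (product fs ≡ prodPow e ps)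
exponents {ps} u [] _ = (λ _ → 0) , (λ _ → ∣-refl) , sym (prodPow-zero ps)
exponents {ps} u (q ∷ fs) (q∈ps ∷ fs⊆ps) with exponents u fs fs⊆ps
... | e , e∣ , fs≡ = bump e q , bump∣ , (begin
    q * product fs    ≡⟨ cong (q *_) fs≡ ⟩
    q * prodPow e ps  ≡⟨ prodPow-bump e u q∈ps ⟨
    prodPow (bump e q) ps ∎)
  where
  open ≡-Reasoning
  bump∣ : ∀ p → p ^ bump e q p ∣ q * product fs
  bump∣ p with p ≟ q
  ... | yes refl = *-monoʳ-∣ p (e∣ p)
  ... | no _ = ∣n⇒∣m*n q (e∣ p)

primesUpTo-unique : ∀ l → Unique (primesUpTo l)
primesUpTo-unique l = filter⁺ prime? (upTo⁺ (2 * l + 2))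

prime≤⇒∈primesUpTo : ∀ l {q} → Prime q → q ≤ 2 * l + 1 → q ∈ primesUpTo l
prime≤⇒∈primesUpTo l pq q≤ =
  ∈-filter⁺ prime? (∈-upTo⁺ (≤-trans (s≤s q≤) (≤-reflexive (sym (+-suc (2 * l) 1))))) pq

∣⇒bounded : ∀ {g n} → g ∣ n → 1 ≤ n → 1 ≤ g × g ≤ n
∣⇒bounded {zero} 0∣n 1≤n = contradiction (subst (1 ≤_) (0∣⇒≡0 0∣n) 1≤n) λ ()
∣⇒bounded {suc _} g∣n 1≤n = s≤s z≤n , ∣⇒≤ {{>-nonZero 1≤n}} g∣n

-- Every g ∈ [1, 2l+1] lies in T(l): its prime factors are primes ≤ 2l+1, and every
-- prime power dividing g is ≤ 2l+1, so its exponent is at most r(p,l).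
small⇒InT : ∀ l {g} → 1 ≤ g → g ≤ 2 * l + 1 → InT l g
small⇒InT l {g} 1≤g g≤ = e , e-bounded , trans g≡ fs≡
  where
  instance
    g≢0 : NonZero g
    g≢0 = >-nonZero 1≤g
  fs : List ℕ
  fs = PrimeFactorisation.factors (factorise g)
  g≡ : g ≡ product fs
  g≡ = PrimeFactorisation.isFactorisation (factorise g)
  factor∈ : ∀ {q} → q ∈ fs → q ∈ primesUpTo l
  factor∈ q∈fs = prime≤⇒∈primesUpTo l (All.lookup (PrimeFactorisation.factorsPrime (factorise g)) q∈fs)
    (≤-trans (∣⇒≤ (subst (_ ∣_) (sym g≡) (∈⇒∣product q∈fs))) g≤)
  exps : Σ (ℕ → ℕ) λ e → (∀ p → p ^ e p ∣ product fs) × (product fs ≡ prodPow e (primesUpTo l))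
  exps = exponents (primesUpTo-unique l) fs (All.tabulate factor∈)
  e : ℕ → ℕ
  e = proj₁ exps
  fs≡ : product fs ≡ prodPow e (primesUpTo l)
  fs≡ = proj₂ (proj₂ exps)
  e-bounded : (p : ℕ) → Prime p → p ≤ 2 * l + 1 → e p ≤ r p l
  e-bounded p pp _ = r-maximal l pp (≤-trans (∣⇒≤ (subst (p ^ e p ∣_) (sym g≡) (proj₁ (proj₂ exps) p))) g≤)

∣-∸ : ∀ {g u v} → u ≤ v → g ∣ u → g ∣ v → g ∣ v ∸ u
∣-∸ u≤v g∣u g∣v = ∣m+n∣m⇒∣n (subst (_ ∣_) (sym (m+[n∸m]≡n u≤v)) g∣v) g∣u

∣-dist : ∀ {g u v} → g ∣ u → g ∣ v → g ∣ ∣ u - v ∣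
∣-dist {g} {u} {v} g∣u g∣v with ≤-total u v
... | inj₁ u≤v = subst (g ∣_) (sym (m≤n⇒∣m-n∣≡n∸m u≤v)) (∣-∸ u≤v g∣u g∣v)
... | inj₂ v≤u = subst (g ∣_) (∣-∣-comm v u) (subst (g ∣_) (sym (m≤n⇒∣m-n∣≡n∸m v≤u)) (∣-∸ v≤u g∣v g∣u))

common-divisor≤dist : ∀ {g u v} → g ∣ u → g ∣ v → u ≢ v → g ≤ ∣ u - v ∣
common-divisor≤dist g∣u g∣v u≢v = ∣⇒≤ {{≢-nonZero (u≢v ∘ ∣m-n∣≡0⇒m≡n)}} (∣-dist g∣u g∣v)

∣n! : ∀ {d n} → 1 ≤ d → d ≤ n → d ∣ n !
∣n! {suc d} _ d≤n = ∣-trans (m∣m*n (d !)) (m≤n⇒m!∣n! d≤n)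

n≤n! : ∀ n → n ≤ n !
n≤n! zero = z≤n
n≤n! (suc n) = m≤m*n (suc n) (n !) {{n !≢0}}

module FactorialLadder (K : ℕ) where

  c : ℕ → ℕ
  c zero = 1
  c (suc k) = (c k + K) !

  c-pos : ∀ k → 1 ≤ c k
  c-pos zero = ≤-refl
  c-pos (suc k) = 1≤n! (c k + K)

  c-step : ∀ k → c k + K ≤ c (suc k)
  c-step k = n≤n! (c k + K)

  c-mono : ∀ {i j} → i ≤ j → c i ≤ c j
  c-mono = go ∘ ≤⇒≤′
    where
    go : ∀ {i j} → i ≤′ j → c i ≤ c j
    go (≤′-reflexive refl) = ≤-refl
    go (≤′-step {k} i≤′k) = ≤-trans (go i≤′k) (≤-trans (m≤m+n (c k) K) (c-step k))

  c-strict : 1 ≤ K → ∀ {i j} → i < j → c i < c j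
  c-strict 1≤K {i} i<j = <-≤-trans (<-≤-trans (m<m+n (c i) 1≤K) (c-step i)) (c-mono i<j)

  ladder : ∀ {i j d} → i < j → 1 ≤ d → d ≤ c i + K → d ∣ c j
  ladder {i} {suc j} (s≤s i≤j) 1≤d d≤ =
    ∣-trans (∣n! 1≤d d≤) (m≤n⇒m!∣n! (+-monoˡ-≤ K (c-mono i≤j)))

  data Block (h y : ℕ) : ℕ → Set where
    block : ∀ {i s} → i < h → 1 ≤ s → s ≤ K → Block h y (y + (c i + s))

  -- A common divisor of c_i + s and c_j + t with i < j is at most c_i + K,
  -- so it divides c_j and therefore the offset t.
  lower-block : ∀ {i j s t g} → i < j → 1 ≤ s → s ≤ K → g ∣ c i + s → g ∣ c j + t → g ∣ t
  lower-block {i} {s = s} i<j 1≤s s≤K g∣u g∣v with ∣⇒bounded g∣u (≤-trans 1≤s (m≤n+m s (c i)))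
  ... | 1≤g , g≤u = ∣m+n∣m⇒∣n g∣v (ladder i<j 1≤g (≤-trans g≤u (+-monoʳ-≤ (c i) s≤K)))

  offsets-gcd : ∀ {i j s t g} → 1 ≤ s → s ≤ K → 1 ≤ t → t ≤ K →
                c i + s ≢ c j + t → g ∣ c i + s → g ∣ c j + t → g ≤ K
  offsets-gcd {i} {j} {s} {t} {g} 1≤s s≤K 1≤t t≤K u≢v g∣u g∣v with <-cmp i j
  ... | tri< i<j _ _ = ≤-trans (proj₂ (∣⇒bounded (lower-block i<j 1≤s s≤K g∣u g∣v) 1≤t)) t≤K
  ... | tri> _ _ j<i = ≤-trans (proj₂ (∣⇒bounded (lower-block j<i 1≤t t≤K g∣v g∣u) 1≤s)) s≤K
  ... | tri≈ _ refl _ = begin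
      g                      ≤⟨ common-divisor≤dist g∣u g∣v u≢v ⟩
      ∣ c i + s - c i + t ∣  ≡⟨ ∣m+n-m+o∣≡∣n-o∣ (c i) s t ⟩
      ∣ s - t ∣              ≤⟨ ∣m-n∣≤m⊔n s t ⟩
      s ⊔ t                  ≤⟨ ⊔-lub s≤K t≤K ⟩
      K                      ∎
    where open ≤-Reasoning

  -- Common divisors of distinct block elements above a multiple y of c_h lie in [1, K]:
  -- such a divisor is at most the distance, which is ≤ c_i + K for some i < h, so it
  -- divides c_h and hence y, reducing the claim to offsets-gcd.
  blocks-gcd : ∀ {h y a b g} → c h ∣ y → Block h y a → Block h y b → a ≢ b →
               g ∣ a → g ∣ b → 1 ≤ g × g ≤ K
  blocks-gcd {h} {y} {g = g} ch∣y (block {i} {s} i<h 1≤s s≤K) (block {j} {t} j<h 1≤t t≤K) a≢b g∣a g∣b =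
    1≤g , offsets-gcd {i} {j} 1≤s s≤K 1≤t t≤K (a≢b ∘ cong (y +_)) (∣m+n∣m⇒∣n g∣a g∣y) (∣m+n∣m⇒∣n g∣b g∣y)
    where
    open ≤-Reasoning
    1≤g : 1 ≤ g
    1≤g = proj₁ (∣⇒bounded g∣a (≤-trans 1≤s (≤-trans (m≤n+m s (c i)) (m≤n+m _ y))))
    g≤gap : g ≤ (c i + s) ⊔ (c j + t)
    g≤gap = begin
      g                                      ≤⟨ common-divisor≤dist g∣a g∣b a≢b ⟩
      ∣ y + (c i + s) - y + (c j + t) ∣      ≡⟨ ∣m+n-m+o∣≡∣n-o∣ y (c i + s) (c j + t) ⟩
      ∣ c i + s - c j + t ∣                  ≤⟨ ∣m-n∣≤m⊔n (c i + s) (c j + t) ⟩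
      (c i + s) ⊔ (c j + t)                  ∎
    g∣ch : g ∣ c h
    g∣ch with ⊔-sel (c i + s) (c j + t)
    ... | inj₁ ≡u = ladder i<h 1≤g (≤-trans g≤gap (≤-trans (≤-reflexive ≡u) (+-monoʳ-≤ (c i) s≤K)))
    ... | inj₂ ≡v = ladder j<h 1≤g (≤-trans g≤gap (≤-trans (≤-reflexive ≡v) (+-monoʳ-≤ (c j) t≤K)))
    g∣y : g ∣ y
    g∣y = ∣-trans g∣ch ch∣y

nextMultiple : ℕ → (F : ℕ) → .{{NonZero F}} → ℕ
nextMultiple n F = suc (n / F) * F

module _ (n F : ℕ) .{{_ : NonZero F}} where

  nextMultiple-∣ : F ∣ nextMultiple n F
  nextMultiple-∣ = n∣m*n (suc (n / F))

  <nextMultiple : n < nextMultiple n F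
  <nextMultiple = begin-strict
    n                  ≡⟨ m≡m%n+[m/n]*n n F ⟩
    n % F + n / F * F  <⟨ +-monoˡ-< (n / F * F) (m%n<n n F) ⟩
    nextMultiple n F   ∎
    where open ≤-Reasoning

  nextMultiple≤ : nextMultiple n F ≤ n + F
  nextMultiple≤ = ≤-trans (+-monoʳ-≤ F (m/n*n≤m n F)) (≤-reflexive (+-comm F n))

window : ℕ → ℕ → ℕ
window h l = c h + c h
  where open FactorialLadder (2 * l + 1)

window-pos : ∀ h l → 1 ≤ window h l
window-pos h l = ≤-trans (c-pos h) (m≤m+n _ _)
  where open FactorialLadder (2 * l + 1)

block-offset : ∀ y c o → y + (c + 1) + o ≡ y + (c + (o + 1))
block-offset y c o = begin
  y + (c + 1) + o    ≡⟨ +-assoc y (c + 1) o ⟩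
  y + (c + 1 + o)    ≡⟨ cong (y +_) (+-assoc c 1 o) ⟩
  y + (c + (1 + o))  ≡⟨ cong (λ k → y + (c + k)) (+-comm 1 o) ⟩
  y + (c + (o + 1))  ∎
  where open ≡-Reasoning

module BlockConstruction (l h n : ℕ) where
  open FactorialLadder (2 * l + 1)

  instance
    c[h]≢0 : NonZero (c h)
    c[h]≢0 = >-nonZero (c-pos h)

  y : ℕ
  y = nextMultiple n (c h)

  x : Fin h → ℕ
  x i = y + (c (toℕ i) + 1)

  x-pos : (i : Fin h) → 1 ≤ x i
  x-pos i = ≤-trans (m≤n+m 1 (c (toℕ i))) (m≤n+m _ y)

  x-increasing : StrictlyIncreasing x
  x-increasing i j i<j = +-monoʳ-< y (+-monoˡ-< 1 (c-strict (m≤n+m 1 (2 * l)) i<j))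

  x-range : (i : Fin h) → (n ≤ x i) × (x i + 2 * l ≤ n + window h l)
  x-range i = ≤-trans (<⇒≤ (<nextMultiple n (c h))) (m≤m+n y _) , (begin
    x i + 2 * l                  ≡⟨ block-offset y (c (toℕ i)) (2 * l) ⟩
    y + (c (toℕ i) + (2 * l + 1)) ≤⟨ +-monoʳ-≤ y (c-step (toℕ i)) ⟩
    y + c (suc (toℕ i))          ≤⟨ +-mono-≤ (nextMultiple≤ n (c h)) (c-mono (toℕ<n i)) ⟩
    n + c h + c h                ≡⟨ +-assoc n (c h) (c h) ⟩
    n + window h l               ∎)
    where open ≤-Reasoning

  InS⇒Block : ∀ {a} → InS l x a → Block h y a
  InS⇒Block (i , xᵢ≤a , a≤xᵢ+2l) with m≤n⇒∃[o]m+o≡n xᵢ≤a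
  ... | o , refl = subst (Block h y) (sym (block-offset y (c (toℕ i)) o))
        (block (toℕ<n i) (m≤n+m 1 o) (+-monoˡ-≤ 1 (+-cancelˡ-≤ (x i) o (2 * l) a≤xᵢ+2l)))

  gcd-in-T : (a b : ℕ) → InS l x a → InS l x b → a ≢ b → InT l (gcd a b)
  gcd-in-T a b a∈S b∈S a≢b = uncurry (small⇒InT l)
    (blocks-gcd (nextMultiple-∣ n (c h)) (InS⇒Block a∈S) (InS⇒Block b∈S) a≢b
                (gcd[m,n]∣m a b) (gcd[m,n]∣n a b))

corollary3p6 : Σ (ℕ → ℕ → ℕ) λ m →
    ((h l : ℕ) → 1 ≤ h → 1 ≤ l → 1 ≤ m h l) ×
    ((h l n : ℕ) → 1 ≤ h → 1 ≤ l → 1 ≤ n →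
      Σ (Fin h → ℕ) λ x →
        ((i : Fin h) → 1 ≤ x i) ×
        StrictlyIncreasing x ×
        ((i : Fin h) → (n ≤ x i) × (x i + 2 * l ≤ n + m h l)) ×
        ((a b : ℕ) → InS l x a → InS l x b → a ≢ b → InT l (gcd a b)))
corollary3p6 = window , (λ h l _ _ → window-pos h l) , λ h l n _ _ _ →
  let open BlockConstruction l h n in x , x-pos , x-increasing , x-range , gcd-in-T
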